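{- Let $T$ be a tree of order at least three and let $e$ be an edge of the complement of $T$ (i.e., $e$ joins two non-adjacent vertices of $T$), and let $T+e$ be the unicyclic graph obtained by adding $e$ to $T$. Then $sdim(T+e) \ge sdim(T)-2$. Moreover, this bound is sharp: there exist a tree $T$ of order at least three and such an edge $e$ with $sdim(T+e)=sdim(T)-2$.
   Context: A vertex $x$ strongly resolves a pair of vertices $u,v$ of a connected graph $G$ if $u$ lies on some shortest $x$–$v$ path or $v$ lies on some shortest $x$–$u$ path. A set $W \subseteq V(G)$ is a strong resolving set if every pair of distinct vertices is strongly resolved by some vertex of $W$; $sdim(G)$ is the minimum cardinality of a strong resolving set of $G$. -}

module Defs where

open import Data.Nat using (ℕ; zero; suc; _≤_; _+_)
open import Data.Fin using (Fin; _≟_)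
open import Data.Fin.Subset using (Subset; _∈_; ∣_∣)
open import Data.Bool using (Bool; true; false; _∨_; _∧_)
open import Data.List using (List; []; _∷_)
open import Data.List.Relation.Unary.Unique.Propositional using (Unique)
import Data.List.Membership.Propositional as LM
open import Data.Product using (Σ; _×_; ∃; ∃-syntax)
open import Data.Sum using (_⊎_)
open import Relation.Nullary using (¬_)
open import Relation.Nullary.Decidable using (⌊_⌋)
open import Relation.Binary.PropositionalEquality using (_≡_)

Graph : ℕ → Set
Graph n = Fin n → Fin n → Bool

Adj : ∀ {n} → Graph n → Fin n → Fin n → Set
Adj G u v = G u v ≡ true

IsSimple : ∀ {n} → Graph n → Set
IsSimple {n} G = (∀ (u v : Fin n) → G u v ≡ G v u) × (∀ (u : Fin n) → G u u ≡ false)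

data Walk {n} (G : Graph n) : Fin n → Fin n → Set where
  []  : ∀ {x} → Walk G x x
  _∷_ : ∀ {x y z} → Adj G x y → Walk G y z → Walk G x z

len : ∀ {n} {G : Graph n} {x y} → Walk G x y → ℕ
len []      = zero
len (_ ∷ w) = suc (len w)

verts : ∀ {n} {G : Graph n} {x y} → Walk G x y → List (Fin n)
verts {x = x} []      = x ∷ []
verts {x = x} (_ ∷ w) = x ∷ verts w

Connected : ∀ {n} → Graph n → Set
Connected {n} G = ∀ (x y : Fin n) → Walk G x y

-- a cycle: closed walk of length ≥ 3 whose vertices (not repeating the
-- base point at the end) are pairwise distinct
tailV : ∀ {n} → List (Fin n) → List (Fin n)
tailV []       = []
tailV (_ ∷ xs) = xs

IsCycle : ∀ {n} {G : Graph n} {x} → Walk G x x → Set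
IsCycle w = (3 ≤ len w) × Unique (tailV (verts w))

Acyclic : ∀ {n} → Graph n → Set
Acyclic {n} G = ∀ (x : Fin n) (w : Walk G x x) → ¬ IsCycle w

IsTree : ∀ {n} → Graph n → Set
IsTree G = IsSimple G × Connected G × Acyclic G

addEdge : ∀ {n} → Graph n → Fin n → Fin n → Graph n
addEdge G a b u v =
  G u v ∨ ((⌊ u ≟ a ⌋ ∧ ⌊ v ≟ b ⌋) ∨ (⌊ u ≟ b ⌋ ∧ ⌊ v ≟ a ⌋))

IsShortest : ∀ {n} {G : Graph n} {x y} → Walk G x y → Set
IsShortest {G = G} {x} {y} w = ∀ (w' : Walk G x y) → len w ≤ len w'

OnShortest : ∀ {n} → Graph n → Fin n → Fin n → Fin n → Set
OnShortest G x u v = Σ (Walk G x v) λ w → IsShortest w × u LM.∈ verts w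

StronglyResolves : ∀ {n} → Graph n → Fin n → Fin n → Fin n → Set
StronglyResolves G x u v = OnShortest G x u v ⊎ OnShortest G x v u

IsStrongResolving : ∀ {n} → Graph n → Subset n → Set
IsStrongResolving {n} G W =
  ∀ (u v : Fin n) → ¬ u ≡ v → ∃[ x ] (x ∈ W × StronglyResolves G x u v)

IsSdim : ∀ {n} → Graph n → ℕ → Set
IsSdim {n} G k =
  (∃[ W ] (IsStrongResolving G W × ∣ W ∣ ≡ k)) ×
  (∀ (W : Subset n) → IsStrongResolving G W → k ≤ ∣ W ∣)

-- Let W be a strong resolving set of H = T + ab and let u lie on a shortest x–v path P of H.
-- Cutting P at its traversals of ab leaves geodesics of T, and in a tree a vertex on the
-- geodesic between y and c lies on the geodesic from y or from c to any v.  Hence a pair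
-- strongly resolved by x in H is strongly resolved in T by x, a or b, so W ∪ {a, b} is a
-- strong resolving set of T and sdim T ≤ sdim H + 2.
--
-- For sharpness, two distinct leaves are strongly resolved only by themselves, so a strong
-- resolving set misses at most one leaf.  The tree below has six leaves and sdim 5; joining
-- two of its leaves yields a unicyclic graph with four leaves and sdim 3.

module Submission where

open import Defs
open import Data.Nat using (ℕ; zero; suc; _≤_; _<_; _+_; z≤n; s≤s; _≤?_)
import Data.Nat as ℕ
open import Data.Nat.Properties
  using (≤-reflexive; ≤-trans; <⇒≱; ≮⇒≥; m≤m+n; m≤n+m; n≤1+n; ≤-pred; pred-mono-≤;
         +-suc; +-comm; 0≢1+n; +-monoʳ-≤; +-cancelˡ-≤; +-cancelʳ-≤; suc-injective;
         anyUpTo?; module ≤-Reasoning)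
open import Data.Nat.Induction using (<-wellFounded)
open import Induction.WellFounded using (Acc; acc)
open import Data.Bool using (Bool; T)
import Data.Bool as Bool
open import Data.Bool.Properties using (T-≡)
open import Data.Fin using (Fin; _≟_; toℕ; #_)
open import Data.Fin.Properties using (any?; all?)
open import Data.Fin.Subset using (Subset; inside; outside; ⁅_⁆; _∪_; ∣_∣)
  renaming (_∈_ to _∈ₛ_; _⊆_ to _⊆ₛ_)
open import Data.Fin.Subset.Properties
  using (x∈p∪q⁺; x∈⁅x⁆; ∣⁅x⁆∣≡1; p⊆q⇒∣p∣≤∣q∣) renaming (_∈?_ to _∈ₛ?_)
open import Data.List using (List; []; _∷_)
open import Data.List.Relation.Unary.Any using (here; there)
open import Data.List.Relation.Unary.All using ([])
import Data.List.Relation.Unary.All as All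
open import Data.List.Relation.Unary.All.Properties using (¬Any⇒All¬)
open import Data.List.Relation.Unary.AllPairs using ([]; _∷_)
open import Data.List.Relation.Unary.Unique.Propositional using (Unique)
open import Data.List.Membership.Propositional using (_∈_; _∉_)
open import Data.List.Relation.Binary.Subset.Propositional using (_⊆_)
open import Data.Vec using (Vec; []; _∷_; lookup)
open import Data.Product using (Σ; _×_; ∃-syntax; _,_; proj₁; map₂)
open import Data.Sum using (_⊎_; inj₁; inj₂)
import Data.Sum as Sum
open import Data.Empty using (⊥; ⊥-elim)
open import Function using (_∘_; id)
open import Function.Bundles using (module Equivalence)
open import Axiom.UniquenessOfIdentityProofs using (module Decidable⇒UIP)
open import Relation.Nullary using (¬_; Dec; does; yes; no)
open import Relation.Nullary.Decidable
  using (T?; dec-true; from-yes; map′; _×-dec_; _⊎-dec_; _→-dec_; ¬?; decidable-stable)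
open import Relation.Binary.PropositionalEquality
  using (_≡_; refl; sym; trans; cong; cong₂; subst; subst₂)

module _ {n} {G : Graph n} where

  open import Data.List.Membership.DecPropositional (_≟_ {n}) using (_∈?_)

  infixr 5 _⊕_
  _⊕_ : ∀ {x y z} → Walk G x y → Walk G y z → Walk G x z
  []      ⊕ q = q
  (e ∷ p) ⊕ q = e ∷ (p ⊕ q)

  len-⊕ : ∀ {x y z} (p : Walk G x y) (q : Walk G y z) → len (p ⊕ q) ≡ len p + len q
  len-⊕ []      q = refl
  len-⊕ (e ∷ p) q = cong suc (len-⊕ p q)

  ⊕-assoc : ∀ {w x y z} (p : Walk G w x) (q : Walk G x y) (r : Walk G y z) →
            (p ⊕ q) ⊕ r ≡ p ⊕ (q ⊕ r)
  ⊕-assoc []      q r = refl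
  ⊕-assoc (e ∷ p) q r = cong (e ∷_) (⊕-assoc p q r)

  start∈verts : ∀ {x y} (w : Walk G x y) → x ∈ verts w
  start∈verts []      = here refl
  start∈verts (_ ∷ _) = here refl

  end∈verts : ∀ {x y} (w : Walk G x y) → y ∈ verts w
  end∈verts []      = here refl
  end∈verts (_ ∷ w) = there (end∈verts w)

  ∈-⊕⁻ : ∀ {u x y z} (p : Walk G x y) (q : Walk G y z) →
         u ∈ verts (p ⊕ q) → u ∈ verts p ⊎ u ∈ verts q
  ∈-⊕⁻ []      q u∈q         = inj₂ u∈q
  ∈-⊕⁻ (e ∷ p) q (here refl) = inj₁ (here refl)
  ∈-⊕⁻ (e ∷ p) q (there u∈)  with ∈-⊕⁻ p q u∈
  ... | inj₁ u∈p = inj₁ (there u∈p)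
  ... | inj₂ u∈q = inj₂ u∈q

  ∈-⊕ʳ : ∀ {u x y z} (p : Walk G x y) (q : Walk G y z) → u ∈ verts q → u ∈ verts (p ⊕ q)
  ∈-⊕ʳ []      q u∈q = u∈q
  ∈-⊕ʳ (e ∷ p) q u∈q = there (∈-⊕ʳ p q u∈q)

  ∈-⊕∷⁻ : ∀ {u x y y′ z} (p : Walk G x y) (e : Adj G y y′) (q : Walk G y′ z) →
          u ∈ verts (p ⊕ e ∷ q) → u ∈ verts p ⊎ u ∈ verts q
  ∈-⊕∷⁻ p e q u∈ with ∈-⊕⁻ p (e ∷ q) u∈
  ... | inj₁ u∈p          = inj₁ u∈p
  ... | inj₂ (here refl)  = inj₁ (end∈verts p)
  ... | inj₂ (there u∈q)  = inj₂ u∈q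

  ∉-⊕ : ∀ {u x y z} (p : Walk G x y) (q : Walk G y z) →
        u ∉ verts p → u ∉ verts q → u ∉ verts (p ⊕ q)
  ∉-⊕ p q u∉p u∉q u∈ with ∈-⊕⁻ p q u∈
  ... | inj₁ u∈p = u∉p u∈p
  ... | inj₂ u∈q = u∉q u∈q

  split : ∀ {u x y} (w : Walk G x y) → u ∈ verts w →
          Σ (Walk G x u) λ w₁ → Σ (Walk G u y) λ w₂ → w ≡ w₁ ⊕ w₂
  split []      (here refl)  = [] , [] , refl
  split (e ∷ w) (here refl)  = [] , e ∷ w , refl
  split (e ∷ w) (there u∈w) with split w u∈w
  ... | w₁ , w₂ , refl = e ∷ w₁ , w₂ , refl

  split-∷ : ∀ {u x y z} (e : Adj G x y) (w : Walk G y z) → u ∈ verts w →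
            ∃[ p ] Σ (Walk G x p) λ w₁ → Σ (Adj G p u) λ f → Σ (Walk G u z) λ w₂ →
              e ∷ w ≡ w₁ ⊕ f ∷ w₂
  split-∷ e []       (here refl)  = _ , [] , e , [] , refl
  split-∷ e (e′ ∷ w) (here refl)  = _ , [] , e , e′ ∷ w , refl
  split-∷ e (e′ ∷ w) (there u∈w) with split-∷ e′ w u∈w
  ... | _ , w₁ , f , w₂ , eq = _ , e ∷ w₁ , f , w₂ , cong (e ∷_) eq

  interior-split : ∀ {u x y} (w : Walk G x y) → u ∈ verts w → ¬ u ≡ x → ¬ u ≡ y →
    ∃[ p ] ∃[ q ] Σ (Walk G x p) λ w₁ → Σ (Adj G p u) λ f → Σ (Adj G u q) λ e →
      Σ (Walk G q y) λ w₂ → w ≡ w₁ ⊕ f ∷ e ∷ w₂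
  interior-split []      (here refl) u≢x _ = ⊥-elim (u≢x refl)
  interior-split (e ∷ w) (here refl) u≢x _ = ⊥-elim (u≢x refl)
  interior-split (e ∷ w) (there u∈w) u≢x u≢y with split-∷ e w u∈w
  ... | _ , w₁ , f , []      , _  = ⊥-elim (u≢y refl)
  ... | _ , w₁ , f , e′ ∷ w₂ , eq = _ , _ , w₁ , f , e′ , w₂ , eq

  shortest-prefix : ∀ {x y z} (p : Walk G x y) (q : Walk G y z) →
                    IsShortest (p ⊕ q) → IsShortest p
  shortest-prefix p q sh p′ = +-cancelʳ-≤ (len q) (len p) (len p′)
    (subst₂ _≤_ (len-⊕ p q) (len-⊕ p′ q) (sh (p′ ⊕ q)))

  shortest-suffix : ∀ {x y z} (p : Walk G x y) (q : Walk G y z) →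
                    IsShortest (p ⊕ q) → IsShortest q
  shortest-suffix p q sh q′ = +-cancelˡ-≤ (len p) (len q) (len q′)
    (subst₂ _≤_ (len-⊕ p q) (len-⊕ p q′) (sh (p ⊕ q′)))

  len-⊕-≥ˡ : ∀ {x y z} (p : Walk G x y) (q : Walk G y z) → len p ≤ len (p ⊕ q)
  len-⊕-≥ˡ p q = ≤-trans (m≤m+n (len p) (len q)) (≤-reflexive (sym (len-⊕ p q)))

  len-⊕-≥ʳ : ∀ {x y z} (p : Walk G x y) (q : Walk G y z) → len q ≤ len (p ⊕ q)
  len-⊕-≥ʳ p q = ≤-trans (m≤n+m (len q) (len p)) (≤-reflexive (sym (len-⊕ p q)))

  len-∷ʳ : ∀ {x y z} (w : Walk G x y) (f : Adj G y z) → len (w ⊕ f ∷ []) ≡ suc (len w)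
  len-∷ʳ []      f = refl
  len-∷ʳ (e ∷ w) f = cong suc (len-∷ʳ w f)

  shortest⇒start∉ : ∀ {x y z} (e : Adj G x y) (w : Walk G y z) →
                    IsShortest (e ∷ w) → x ∉ verts w
  shortest⇒start∉ e w sh x∈w with split w x∈w
  ... | w₁ , w₂ , refl = <⇒≱ (s≤s (len-⊕-≥ʳ w₁ w₂)) (sh w₂)

  shortest⇒end∉ : ∀ {x y z} (w : Walk G x y) (f : Adj G y z) →
                  IsShortest (w ⊕ f ∷ []) → z ∉ verts w
  shortest⇒end∉ w f sh z∈w with split w z∈w
  ... | w₁ , w₂ , refl =
    <⇒≱ (≤-trans (s≤s (len-⊕-≥ˡ w₁ w₂)) (≤-reflexive (sym (len-∷ʳ (w₁ ⊕ w₂) f)))) (sh w₁)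

  shortest⇒¬backtrack : ∀ {x y z} (f : Adj G x y) (e : Adj G y x) (w : Walk G x z) →
                        ¬ IsShortest (f ∷ e ∷ w)
  shortest⇒¬backtrack f e w sh = <⇒≱ (s≤s (n≤1+n (len w))) (sh w)

  Unique-suffix : ∀ {x y z} (p : Walk G x y) (q : Walk G y z) →
                  Unique (verts (p ⊕ q)) → Unique (verts q)
  Unique-suffix []      q uniq       = uniq
  Unique-suffix (e ∷ p) q (_ ∷ uniq) = Unique-suffix p q uniq

  loop-erase : ∀ {x y} (w : Walk G x y) →
               Σ (Walk G x y) λ π → Unique (verts π) × verts π ⊆ verts w
  loop-erase [] = [] , [] ∷ [] , id
  loop-erase {x} (e ∷ w) with loop-erase w
  ... | π , π-unique , π⊆w with x ∈? verts π
  ...   | no x∉π = e ∷ π , ¬Any⇒All¬ _ x∉π ∷ π-unique ,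
                    λ { (here refl) → here refl ; (there u∈π) → there (π⊆w u∈π) }
  ...   | yes x∈π with split π x∈π
  ...     | π₁ , π₂ , refl = π₂ , Unique-suffix π₁ π₂ π-unique , there ∘ π⊆w ∘ ∈-⊕ʳ π₁ π₂

  reverse : (∀ u v → G u v ≡ G v u) → ∀ {x y} → Walk G x y → Walk G y x
  reverse sym-G []                  = []
  reverse sym-G {x} (_∷_ {y = y} e w) = reverse sym-G w ⊕ trans (sym-G y x) e ∷ []

  ∈-reverse⁻ : (sym-G : ∀ u v → G u v ≡ G v u) → ∀ {u x y} (w : Walk G x y) →
               u ∈ verts (reverse sym-G w) → u ∈ verts w
  ∈-reverse⁻ sym-G []      u∈ = u∈
  ∈-reverse⁻ sym-G (e ∷ w) u∈ with ∈-⊕⁻ (reverse sym-G w) _ u∈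
  ... | inj₁ u∈rw               = there (∈-reverse⁻ sym-G w u∈rw)
  ... | inj₂ (here refl)        = there (start∈verts w)
  ... | inj₂ (there (here refl)) = here refl

  walk-of-length? : ∀ k x y → Dec (Σ (Walk G x y) λ w → len w ≡ k)
  walk-of-length? zero x y with x ≟ y
  ... | yes refl = yes ([] , refl)
  ... | no x≢y   = no λ { ([] , _) → x≢y refl ; (_ ∷ _ , ()) }
  walk-of-length? (suc k) x y =
    map′ (λ { (_ , e , w , refl) → e ∷ w , refl })
         (λ { (e ∷ w , eq) → _ , e , w , suc-injective eq })
         (any? λ z → (G x z Bool.≟ Bool.true) ×-dec walk-of-length? k z y)

  shortest-walk : ∀ {x y} → Walk G x y → Σ (Walk G x y) IsShortest
  shortest-walk {x} {y} w = descend w (<-wellFounded (len w))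
    where
    descend : (w : Walk G x y) → Acc _<_ (len w) → Σ (Walk G x y) IsShortest
    descend w (acc shorter) with anyUpTo? (λ k → walk-of-length? k x y) (len w)
    ... | yes (_ , k<len , w′ , refl) = descend w′ (shorter k<len)
    ... | no ∄shorter = w , λ w′ → ≮⇒≥ λ w′<w → ∄shorter (len w′ , w′<w , w′ , refl)

  distinct-ends⇒len≥1 : ∀ {x y} (w : Walk G x y) → ¬ x ≡ y → 1 ≤ len w
  distinct-ends⇒len≥1 []      x≢y = ⊥-elim (x≢y refl)
  distinct-ends⇒len≥1 (_ ∷ _) _   = s≤s z≤n

  -- p – u – q together with a u-avoiding q–p walk closes up, after loop erasure, into a cycle.
  acyclic⇒¬detour : Acyclic G → ∀ {p u q} → ¬ q ≡ p → Adj G p u → Adj G u q →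
                    (δ : Walk G q p) → u ∉ verts δ → ⊥
  acyclic⇒¬detour acyclic q≢p f e δ u∉δ with loop-erase δ
  ... | π , π-unique , π⊆δ = acyclic _ (f ∷ e ∷ π)
        (s≤s (s≤s (distinct-ends⇒len≥1 π q≢p)) , ¬Any⇒All¬ _ (u∉δ ∘ π⊆δ) ∷ π-unique)

  geodesic-interior-separates : Acyclic G → ∀ {u x y} (w : Walk G x y) → IsShortest w →
    u ∈ verts w → ¬ u ≡ x → ¬ u ≡ y → (γ : Walk G y x) → u ∉ verts γ → ⊥
  geodesic-interior-separates acyclic w sh u∈w u≢x u≢y γ u∉γ
    with interior-split w u∈w u≢x u≢y
  ... | p , q , w₁ , f , e , w₂ , refl =
    acyclic⇒¬detour acyclic q≢p f e (w₂ ⊕ γ ⊕ w₁) (∉-⊕ w₂ _ u∉w₂ (∉-⊕ γ w₁ u∉γ u∉w₁))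
    where
    turn-shortest : IsShortest (f ∷ e ∷ w₂)
    turn-shortest = shortest-suffix w₁ (f ∷ e ∷ w₂) sh
    q≢p : ¬ q ≡ p
    q≢p refl = shortest⇒¬backtrack f e w₂ turn-shortest
    u∉w₂ : _ ∉ verts w₂
    u∉w₂ = shortest⇒start∉ e w₂ (shortest-suffix (f ∷ []) (e ∷ w₂) turn-shortest)
    u∉w₁ : _ ∉ verts w₁
    u∉w₁ = shortest⇒end∉ w₁ f (shortest-prefix (w₁ ⊕ f ∷ []) (e ∷ w₂)
             (subst IsShortest (sym (⊕-assoc w₁ (f ∷ []) (e ∷ w₂))) sh))

module _ {n} {T : Graph n} where

  open import Data.List.Membership.DecPropositional (_≟_ {n}) using (_∈?_)

  -- Otherwise S′ ⊕ reverse S would be a c–y walk avoiding the interior vertex u of Q.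
  geodesic-branch : IsTree T → ∀ {u y c} (Q : Walk T y c) → IsShortest Q → u ∈ verts Q →
                    ∀ v → OnShortest T y u v ⊎ OnShortest T c u v
  geodesic-branch ((sym-T , _) , connected , acyclic) {u} {y} {c} Q sh u∈Q v
    with shortest-walk (connected y v) | shortest-walk (connected c v)
  ... | S , S-sh | S′ , S′-sh with u ∈? verts S | u ∈? verts S′
  ... | yes u∈S | _        = inj₁ (S , S-sh , u∈S)
  ... | no _    | yes u∈S′ = inj₂ (S′ , S′-sh , u∈S′)
  ... | no u∉S  | no u∉S′  = ⊥-elim (geodesic-interior-separates acyclic Q sh u∈Q
          (λ { refl → u∉S (start∈verts S) }) (λ { refl → u∉S′ (start∈verts S′) })
          (S′ ⊕ reverse sym-T S) (∉-⊕ S′ _ u∉S′ (u∉S ∘ ∈-reverse⁻ sym-T S)))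

∣p∪q∣≤∣p∣+∣q∣ : ∀ {m} (p q : Subset m) → ∣ p ∪ q ∣ ≤ ∣ p ∣ + ∣ q ∣
∣p∪q∣≤∣p∣+∣q∣ []            []            = z≤n
∣p∪q∣≤∣p∣+∣q∣ (inside  ∷ p) (inside  ∷ q) =
  s≤s (≤-trans (∣p∪q∣≤∣p∣+∣q∣ p q) (+-monoʳ-≤ ∣ p ∣ (n≤1+n ∣ q ∣)))
∣p∪q∣≤∣p∣+∣q∣ (inside  ∷ p) (outside ∷ q) = s≤s (∣p∪q∣≤∣p∣+∣q∣ p q)
∣p∪q∣≤∣p∣+∣q∣ (outside ∷ p) (inside  ∷ q) =
  ≤-trans (s≤s (∣p∪q∣≤∣p∣+∣q∣ p q)) (≤-reflexive (sym (+-suc ∣ p ∣ ∣ q ∣)))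
∣p∪q∣≤∣p∣+∣q∣ (outside ∷ p) (outside ∷ q) = ∣p∪q∣≤∣p∣+∣q∣ p q

-- W misses at most one point of L.
pair-cover⇒∣L∣≤1+∣W∣ : ∀ {m} (L W : Subset m) →
  (∀ {u v} → u ∈ₛ L → v ∈ₛ L → ¬ u ≡ v → u ∈ₛ W ⊎ v ∈ₛ W) → ∣ L ∣ ≤ suc ∣ W ∣
pair-cover⇒∣L∣≤1+∣W∣ L W cover with any? (λ u → (u ∈ₛ? L) ×-dec ¬? (u ∈ₛ? W))
... | yes (u₀ , u₀∈L , u₀∉W) = begin
  ∣ L ∣              ≤⟨ p⊆q⇒∣p∣≤∣q∣ L⊆W∪u₀ ⟩
  ∣ W ∪ ⁅ u₀ ⁆ ∣     ≤⟨ ∣p∪q∣≤∣p∣+∣q∣ W ⁅ u₀ ⁆ ⟩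
  ∣ W ∣ + ∣ ⁅ u₀ ⁆ ∣ ≡⟨ trans (cong (∣ W ∣ +_) (∣⁅x⁆∣≡1 u₀)) (+-comm ∣ W ∣ 1) ⟩
  suc ∣ W ∣          ∎
  where
  open ≤-Reasoning
  L⊆W∪u₀ : L ⊆ₛ W ∪ ⁅ u₀ ⁆
  L⊆W∪u₀ {v} v∈L with v ≟ u₀
  ... | yes refl = x∈p∪q⁺ (inj₂ (x∈⁅x⁆ v))
  ... | no v≢u₀ with cover v∈L u₀∈L v≢u₀
  ...   | inj₁ v∈W  = x∈p∪q⁺ (inj₁ v∈W)
  ...   | inj₂ u₀∈W = ⊥-elim (u₀∉W u₀∈W)
... | no ∄u∈L∖W = ≤-trans (p⊆q⇒∣p∣≤∣q∣ L⊆W) (n≤1+n ∣ W ∣)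
  where
  L⊆W : L ⊆ₛ W
  L⊆W {v} v∈L = decidable-stable (v ∈ₛ? W) λ v∉W → ∄u∈L∖W (v , v∈L , v∉W)

module AddEdge {n} (T : Graph n) (a b : Fin n) where

  H : Graph n
  H = addEdge T a b

  NewEnd : Fin n → Set
  NewEnd r = r ≡ a ⊎ r ≡ b

  Adj-addEdge⁻ : ∀ {x y} → Adj H x y → Adj T x y ⊎ (NewEnd x × NewEnd y)
  Adj-addEdge⁻ {x} {y} h with T x y
  ... | Bool.true  = inj₁ refl
  ... | Bool.false with x ≟ a | y ≟ b | x ≟ b | y ≟ a | h
  ...   | yes x≡a | yes y≡b | _       | _       | _  = inj₂ (inj₁ x≡a , inj₂ y≡b)
  ...   | _       | _       | yes x≡b | yes y≡a | _  = inj₂ (inj₂ x≡b , inj₁ y≡a)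
  ...   | no _    | _       | no _    | _       | ()
  ...   | no _    | _       | yes _   | no _    | ()
  ...   | yes _   | no _    | no _    | _       | ()
  ...   | yes _   | no _    | yes _   | no _    | ()

  Adj-addEdge⁺ : ∀ {x y} → Adj T x y → Adj H x y
  Adj-addEdge⁺ t = cong (Bool._∨ _) t

  lift : ∀ {x y} → Walk T x y → Walk H x y
  lift []      = []
  lift (t ∷ Q) = Adj-addEdge⁺ t ∷ lift Q

  len-lift : ∀ {x y} (Q : Walk T x y) → len (lift Q) ≡ len Q
  len-lift []      = refl
  len-lift (t ∷ Q) = cong suc (len-lift Q)

  verts-lift : ∀ {x y} (Q : Walk T x y) → verts (lift Q) ≡ verts Q
  verts-lift []      = refl
  verts-lift (t ∷ Q) = cong (_ ∷_) (verts-lift Q)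

  shortest-lift⇒shortest : ∀ {x y} (Q : Walk T x y) → IsShortest (lift Q) → IsShortest Q
  shortest-lift⇒shortest Q sh Q′ = subst₂ _≤_ (len-lift Q) (len-lift Q′) (sh (lift Q′))

  -- A walk in H, cut at its traversals of the new edge into walks of T.
  data Route : ∀ {y v} → Walk H y v → Set where
    tree  : ∀ {y v} (Q : Walk T y v) → Route (lift Q)
    cross : ∀ {y c c′ v} (Q : Walk T y c) (h : Adj H c c′) {P : Walk H c′ v} →
            NewEnd c → NewEnd c′ → Route P → Route (lift Q ⊕ h ∷ P)

  route : ∀ {y v} (P : Walk H y v) → Route P
  route []      = tree []
  route (h ∷ P) with Adj-addEdge⁻ h
  ... | inj₂ (c-end , c′-end) = cross [] h c-end c′-end (route P)
  -- Adjacency proofs are equalities in Bool, hence h ≡ Adj-addEdge⁺ t.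
  ... | inj₁ t = subst (λ h → Route (h ∷ P)) (Decidable⇒UIP.≡-irrelevant Bool._≟_ _ _)
                   (prepend t (route P))
    where
    prepend : ∀ {x y v} {P : Walk H y v} (t : Adj T x y) → Route P → Route (Adj-addEdge⁺ t ∷ P)
    prepend t (tree Q)                     = tree (t ∷ Q)
    prepend t (cross Q h c-end c′-end rest) = cross (t ∷ Q) h c-end c′-end rest

  module _ (tree-T : IsTree T) where

    route-geodesic : ∀ {y v u} {P : Walk H y v} → Route P → IsShortest P → u ∈ verts P →
                     ∃[ r ] (r ≡ y ⊎ NewEnd r) × OnShortest T r u v
    route-geodesic (tree Q) sh u∈Q =
      _ , inj₁ refl , Q , shortest-lift⇒shortest Q sh , subst (_ ∈_) (verts-lift Q) u∈Q
    route-geodesic {v = v} (cross Q h {P} c-end c′-end rest) sh u∈ with ∈-⊕∷⁻ (lift Q) h P u∈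
    ... | inj₁ u∈Q with geodesic-branch tree-T Q
                          (shortest-lift⇒shortest Q (shortest-prefix (lift Q) (h ∷ P) sh))
                          (subst (_ ∈_) (verts-lift Q) u∈Q) v
    ...   | inj₁ on = _ , inj₁ refl , on
    ...   | inj₂ on = _ , inj₂ c-end , on
    route-geodesic (cross Q h {P} c-end c′-end rest) sh u∈ | inj₂ u∈P
      with route-geodesic rest (shortest-suffix (h ∷ []) P (shortest-suffix (lift Q) (h ∷ P) sh)) u∈P
    ...   | r , inj₁ refl  , on = r , inj₂ c′-end , on
    ...   | r , inj₂ r-end , on = r , inj₂ r-end , on

    module _ {W : Subset n} where

      anchor∈ : ∀ {x r} → x ∈ₛ W → r ≡ x ⊎ NewEnd r → r ∈ₛ W ∪ (⁅ a ⁆ ∪ ⁅ b ⁆)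
      anchor∈ x∈W (inj₁ refl)        = x∈p∪q⁺ (inj₁ x∈W)
      anchor∈ x∈W (inj₂ (inj₁ refl)) = x∈p∪q⁺ (inj₂ (x∈p∪q⁺ (inj₁ (x∈⁅x⁆ a))))
      anchor∈ x∈W (inj₂ (inj₂ refl)) = x∈p∪q⁺ (inj₂ (x∈p∪q⁺ (inj₂ (x∈⁅x⁆ b))))

      OnShortest-addEdge⇒∪ : ∀ {x u v} → x ∈ₛ W → OnShortest H x u v →
                             ∃[ r ] r ∈ₛ W ∪ (⁅ a ⁆ ∪ ⁅ b ⁆) × OnShortest T r u v
      OnShortest-addEdge⇒∪ x∈W (P , sh , u∈P) with route-geodesic (route P) sh u∈P
      ... | r , anchor , on = r , anchor∈ x∈W anchor , on

      StrongResolving-addEdge⇒∪ : IsStrongResolving H W →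
                                  IsStrongResolving T (W ∪ (⁅ a ⁆ ∪ ⁅ b ⁆))
      StrongResolving-addEdge⇒∪ resolving u v u≢v with resolving u v u≢v
      ... | x , x∈W , inj₁ on = map₂ (map₂ inj₁) (OnShortest-addEdge⇒∪ x∈W on)
      ... | x , x∈W , inj₂ on = map₂ (map₂ inj₂) (OnShortest-addEdge⇒∪ x∈W on)

  sdim-addEdge-≥ : IsTree T → ∀ {s t} → IsSdim T s → IsSdim H t → s ≤ t + 2
  sdim-addEdge-≥ tree-T (_ , minimal) ((W , resolving , refl) , _) =
    ≤-trans (minimal _ (StrongResolving-addEdge⇒∪ tree-T resolving)) (begin
      ∣ W ∪ (⁅ a ⁆ ∪ ⁅ b ⁆) ∣          ≤⟨ ∣p∪q∣≤∣p∣+∣q∣ W (⁅ a ⁆ ∪ ⁅ b ⁆) ⟩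
      ∣ W ∣ + ∣ ⁅ a ⁆ ∪ ⁅ b ⁆ ∣        ≤⟨ +-monoʳ-≤ ∣ W ∣ (∣p∪q∣≤∣p∣+∣q∣ ⁅ a ⁆ ⁅ b ⁆) ⟩
      ∣ W ∣ + (∣ ⁅ a ⁆ ∣ + ∣ ⁅ b ⁆ ∣)  ≡⟨ cong (∣ W ∣ +_) (cong₂ _+_ (∣⁅x⁆∣≡1 a) (∣⁅x⁆∣≡1 b)) ⟩
      ∣ W ∣ + 2                         ∎)
    where open ≤-Reasoning

Adj? : ∀ {n} (G : Graph n) x y → Dec (Adj G x y)
Adj? G x y = G x y Bool.≟ Bool.true

IsLeaf : ∀ {n} → Graph n → Fin n → Set
IsLeaf G u = ∀ {p q} → Adj G u p → Adj G u q → p ≡ q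

isLeaf? : ∀ {n} (G : Graph n) u → Dec (IsLeaf G u)
isLeaf? G u = map′ (λ leaf {p} {q} → leaf p q) (λ leaf p q → leaf {p} {q})
  (all? λ p → all? λ q → Adj? G u p →-dec (Adj? G u q →-dec (p ≟ q)))

module _ {n} {G : Graph n} (sym-G : ∀ u v → G u v ≡ G v u) where

  leaf-on-shortest⇒end : ∀ {x u v} → IsLeaf G u → OnShortest G x u v → u ≡ x ⊎ u ≡ v
  leaf-on-shortest⇒end {x} {u} {v} leaf (w , sh , u∈w) with u ≟ x | u ≟ v
  ... | yes u≡x | _       = inj₁ u≡x
  ... | no _    | yes u≡v = inj₂ u≡v
  ... | no u≢x  | no u≢v  with interior-split w u∈w u≢x u≢v
  ...   | _ , _ , w₁ , f , e , w₂ , refl with leaf (trans (sym-G _ _) f) e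
  ...     | refl = ⊥-elim (shortest⇒¬backtrack f e w₂ (shortest-suffix w₁ (f ∷ e ∷ w₂) sh))

  leaves-resolved-only-by-themselves : ∀ {x u v} → IsLeaf G u → IsLeaf G v → ¬ u ≡ v →
                                       StronglyResolves G x u v → x ≡ u ⊎ x ≡ v
  leaves-resolved-only-by-themselves leaf-u leaf-v u≢v (inj₁ on)
    with leaf-on-shortest⇒end leaf-u on
  ... | inj₁ u≡x = inj₁ (sym u≡x)
  ... | inj₂ u≡v = ⊥-elim (u≢v u≡v)
  leaves-resolved-only-by-themselves leaf-u leaf-v u≢v (inj₂ on)
    with leaf-on-shortest⇒end leaf-v on
  ... | inj₁ v≡x = inj₂ (sym v≡x)
  ... | inj₂ v≡u = ⊥-elim (u≢v (sym v≡u))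

  StrongResolving⇒leaf-pair-∈ : ∀ {W u v} → IsStrongResolving G W →
                                IsLeaf G u → IsLeaf G v → ¬ u ≡ v → u ∈ₛ W ⊎ v ∈ₛ W
  StrongResolving⇒leaf-pair-∈ resolving leaf-u leaf-v u≢v with resolving _ _ u≢v
  ... | x , x∈W , resolves with leaves-resolved-only-by-themselves leaf-u leaf-v u≢v resolves
  ...   | inj₁ refl = inj₁ x∈W
  ...   | inj₂ refl = inj₂ x∈W

  IsSdim-by-leaves : ∀ {k} (W L : Subset n) → IsStrongResolving G W → ∣ W ∣ ≡ k →
                     (∀ {u} → u ∈ₛ L → IsLeaf G u) → ∣ L ∣ ≡ suc k → IsSdim G k
  IsSdim-by-leaves W L resolving ∣W∣≡k leaves ∣L∣≡1+k =
    (W , resolving , ∣W∣≡k) ,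
    λ W′ resolving′ → ≤-pred (subst (_≤ suc ∣ W′ ∣) ∣L∣≡1+k (pair-cover⇒∣L∣≤1+∣W∣ L W′
      λ u∈L v∈L u≢v → StrongResolving⇒leaf-pair-∈ resolving′ (leaves u∈L) (leaves v∈L) u≢v))

-- Local conditions characterising D as the distance function of G.
record IsDistance {n} (G : Graph n) (D : Fin n → Fin n → ℕ) : Set where
  field
    D-refl    : ∀ x → D x x ≡ 0
    D-edge    : ∀ x z y → Adj G x z → D x y ≤ suc (D z y)
    D-descent : ∀ x y → x ≡ y ⊎ ∃[ z ] Adj G x z × D x y ≡ suc (D z y)

isDistance? : ∀ {n} (G : Graph n) D → Dec (IsDistance G D)
isDistance? G D = map′ (λ (r , e , d) → record { D-refl = r ; D-edge = e ; D-descent = d })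
                       (λ isD → let open IsDistance isD in D-refl , D-edge , D-descent)
  ((all? λ x → D x x ℕ.≟ 0) ×-dec
   (all? λ x → all? λ z → all? λ y → Adj? G x z →-dec (D x y ≤? suc (D z y))) ×-dec
   (all? λ x → all? λ y → (x ≟ y) ⊎-dec any? λ z → Adj? G x z ×-dec (D x y ℕ.≟ suc (D z y))))

module Distance {n} {G : Graph n} {D : Fin n → Fin n → ℕ} (isDistance : IsDistance G D) where
  open IsDistance isDistance

  D≤len : ∀ {x y} (w : Walk G x y) → D x y ≤ len w
  D≤len {x} []      = ≤-reflexive (D-refl x)
  D≤len {x} {y} (_∷_ {y = z} e w) = ≤-trans (D-edge x z y e) (s≤s (D≤len w))

  walk-of-length-D : ∀ k x y → D x y ≡ k → Σ (Walk G x y) λ w → len w ≡ k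
  walk-of-length-D k x y D≡k with D-descent x y
  ... | inj₁ refl = [] , trans (sym (D-refl x)) D≡k
  ... | inj₂ (z , e , D≡1+D) with k
  ...   | zero   = ⊥-elim (0≢1+n (trans (sym D≡k) D≡1+D))
  ...   | suc k′ with walk-of-length-D k′ z y (suc-injective (trans (sym D≡1+D) D≡k))
  ...     | w , len≡k′ = e ∷ w , cong suc len≡k′

  connected : Connected G
  connected x y = proj₁ (walk-of-length-D (D x y) x y refl)

  on-shortest : ∀ {x u v} → D x u + D u v ≡ D x v → OnShortest G x u v
  on-shortest {x} {u} {v} additive with walk-of-length-D _ x u refl | walk-of-length-D _ u v refl
  ... | w₁ , len₁ | w₂ , len₂ = w₁ ⊕ w₂ , shortest , ∈-⊕ʳ w₁ w₂ (start∈verts w₂)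
    where
    shortest : IsShortest (w₁ ⊕ w₂)
    shortest w′ = ≤-trans (≤-reflexive (trans (len-⊕ w₁ w₂)
                    (trans (cong₂ _+_ len₁ len₂) additive))) (D≤len w′)

  DistanceResolving : Subset n → Set
  DistanceResolving W = ∀ u v → u ≡ v ⊎
    ∃[ x ] x ∈ₛ W × (D x u + D u v ≡ D x v ⊎ D x v + D v u ≡ D x u)

  distanceResolving? : ∀ W → Dec (DistanceResolving W)
  distanceResolving? W = all? λ u → all? λ v → (u ≟ v) ⊎-dec any? λ x → (x ∈ₛ? W) ×-dec
    ((D x u + D u v ℕ.≟ D x v) ⊎-dec (D x v + D v u ℕ.≟ D x u))

  DistanceResolving⇒StrongResolving : ∀ {W} → DistanceResolving W → IsStrongResolving G W
  DistanceResolving⇒StrongResolving resolving u v u≢v with resolving u v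
  ... | inj₁ u≡v = ⊥-elim (u≢v u≡v)
  ... | inj₂ (x , x∈W , additive) = x , x∈W , Sum.map on-shortest on-shortest additive

module CycleSearch {n} (G : Graph n) where

  open import Data.List.Membership.DecPropositional (_≟_ {n}) using (_∈?_)

  -- closes fuel x y visited k: is there a path from y to x, of length at least k, that
  -- avoids visited?  An exhausted fuel answers true, so only the answer false is informative.
  mutual
    closes : ℕ → Fin n → Fin n → List (Fin n) → ℕ → Bool
    closes fuel x y visited k with y ≟ x
    ... | yes _ = does (k ℕ.≟ 0)
    closes zero       x y visited k | no _ = Bool.true
    closes (suc fuel) x y visited k | no _ = does (any? (extends? fuel x y visited k))

    extends? : ∀ fuel x y visited k z →
               Dec (Adj G y z × z ∉ y ∷ visited × T (closes fuel x z (y ∷ visited) (ℕ.pred k)))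
    extends? fuel x y visited k z =
      Adj? G y z ×-dec ¬? (z ∈? y ∷ visited) ×-dec T? (closes fuel x z (y ∷ visited) (ℕ.pred k))

  closes-complete : ∀ fuel {x y} visited k (π : Walk G y x) → Unique (verts π) →
                    (∀ {z} → z ∈ verts π → z ∉ visited) → k ≤ len π →
                    closes fuel x y visited k ≡ Bool.true
  closes-complete fuel {x} visited zero [] _ _ _ with x ≟ x
  ... | yes _   = refl
  ... | no x≢x  = ⊥-elim (x≢x refl)
  closes-complete fuel {x} {y} visited k (_∷_ {y = z} e π) (y∉π ∷ π-unique) fresh k≤
    with y ≟ x
  ... | yes refl = ⊥-elim (All.lookup y∉π (end∈verts π) refl)
  closes-complete zero       visited k (e ∷ π) _ _ _ | no _ = refl
  closes-complete (suc fuel) {x} {y} visited k (_∷_ {y = z} e π) (y∉π ∷ π-unique) fresh k≤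
    | no _ = dec-true (any? (extends? fuel x y visited k))
               (z , e , fresh′ (start∈verts π) ,
                Equivalence.from T-≡ (closes-complete fuel (y ∷ visited) (ℕ.pred k) π π-unique
                                        fresh′ (pred-mono-≤ k≤)))
    where
    fresh′ : ∀ {w} → w ∈ verts π → w ∉ y ∷ visited
    fresh′ w∈π (here refl) = All.lookup y∉π w∈π refl
    fresh′ w∈π (there w∈v) = fresh (there w∈π) w∈v

  -- A cycle x → c → ⋯ → x makes its tail a path from c back to x of length ≥ 2.
  no-closing-path⇒acyclic : ∀ fuel → (∀ x c → Adj G x c → closes fuel x c [] 2 ≡ Bool.false) →
                            Acyclic G
  no-closing-path⇒acyclic fuel never x (e ∷ π) (s≤s 2≤len , π-unique) with
    trans (sym (never x _ e)) (closes-complete fuel [] 2 π π-unique (λ _ ()) 2≤len)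
  ... | ()

module Example where

  -- The path 0 – 2 – 4 – 7 – 6 – 9 with pendant vertices 1, 3, 5, 8 attached at 2, 4, 7, 6.
  edge : ℕ → ℕ → Bool
  edge 0 2 = Bool.true
  edge 1 2 = Bool.true
  edge 2 4 = Bool.true
  edge 3 4 = Bool.true
  edge 4 7 = Bool.true
  edge 5 7 = Bool.true
  edge 6 7 = Bool.true
  edge 6 8 = Bool.true
  edge 6 9 = Bool.true
  edge _ _ = Bool.false

  T₀ : Graph 10
  T₀ u v = edge (toℕ u) (toℕ v) Bool.∨ edge (toℕ v) (toℕ u)

  H₀ : Graph 10
  H₀ = addEdge T₀ (# 9) (# 0)

  matrix : Vec (Vec ℕ 10) 10 → Fin 10 → Fin 10 → ℕ
  matrix rows x y = lookup (lookup rows x) y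

  dist-T : Fin 10 → Fin 10 → ℕ
  dist-T = matrix
    ( (0 ∷ 2 ∷ 1 ∷ 3 ∷ 2 ∷ 4 ∷ 4 ∷ 3 ∷ 5 ∷ 5 ∷ [])
    ∷ (2 ∷ 0 ∷ 1 ∷ 3 ∷ 2 ∷ 4 ∷ 4 ∷ 3 ∷ 5 ∷ 5 ∷ [])
    ∷ (1 ∷ 1 ∷ 0 ∷ 2 ∷ 1 ∷ 3 ∷ 3 ∷ 2 ∷ 4 ∷ 4 ∷ [])
    ∷ (3 ∷ 3 ∷ 2 ∷ 0 ∷ 1 ∷ 3 ∷ 3 ∷ 2 ∷ 4 ∷ 4 ∷ [])
    ∷ (2 ∷ 2 ∷ 1 ∷ 1 ∷ 0 ∷ 2 ∷ 2 ∷ 1 ∷ 3 ∷ 3 ∷ [])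
    ∷ (4 ∷ 4 ∷ 3 ∷ 3 ∷ 2 ∷ 0 ∷ 2 ∷ 1 ∷ 3 ∷ 3 ∷ [])
    ∷ (4 ∷ 4 ∷ 3 ∷ 3 ∷ 2 ∷ 2 ∷ 0 ∷ 1 ∷ 1 ∷ 1 ∷ [])
    ∷ (3 ∷ 3 ∷ 2 ∷ 2 ∷ 1 ∷ 1 ∷ 1 ∷ 0 ∷ 2 ∷ 2 ∷ [])
    ∷ (5 ∷ 5 ∷ 4 ∷ 4 ∷ 3 ∷ 3 ∷ 1 ∷ 2 ∷ 0 ∷ 2 ∷ [])
    ∷ (5 ∷ 5 ∷ 4 ∷ 4 ∷ 3 ∷ 3 ∷ 1 ∷ 2 ∷ 2 ∷ 0 ∷ [])
    ∷ [])

  dist-H : Fin 10 → Fin 10 → ℕ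
  dist-H = matrix
    ( (0 ∷ 2 ∷ 1 ∷ 3 ∷ 2 ∷ 4 ∷ 2 ∷ 3 ∷ 3 ∷ 1 ∷ [])
    ∷ (2 ∷ 0 ∷ 1 ∷ 3 ∷ 2 ∷ 4 ∷ 4 ∷ 3 ∷ 5 ∷ 3 ∷ [])
    ∷ (1 ∷ 1 ∷ 0 ∷ 2 ∷ 1 ∷ 3 ∷ 3 ∷ 2 ∷ 4 ∷ 2 ∷ [])
    ∷ (3 ∷ 3 ∷ 2 ∷ 0 ∷ 1 ∷ 3 ∷ 3 ∷ 2 ∷ 4 ∷ 4 ∷ [])
    ∷ (2 ∷ 2 ∷ 1 ∷ 1 ∷ 0 ∷ 2 ∷ 2 ∷ 1 ∷ 3 ∷ 3 ∷ [])
    ∷ (4 ∷ 4 ∷ 3 ∷ 3 ∷ 2 ∷ 0 ∷ 2 ∷ 1 ∷ 3 ∷ 3 ∷ [])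
    ∷ (2 ∷ 4 ∷ 3 ∷ 3 ∷ 2 ∷ 2 ∷ 0 ∷ 1 ∷ 1 ∷ 1 ∷ [])
    ∷ (3 ∷ 3 ∷ 2 ∷ 2 ∷ 1 ∷ 1 ∷ 1 ∷ 0 ∷ 2 ∷ 2 ∷ [])
    ∷ (3 ∷ 5 ∷ 4 ∷ 4 ∷ 3 ∷ 3 ∷ 1 ∷ 2 ∷ 0 ∷ 2 ∷ [])
    ∷ (1 ∷ 3 ∷ 2 ∷ 4 ∷ 3 ∷ 3 ∷ 1 ∷ 2 ∷ 2 ∷ 0 ∷ [])
    ∷ [])

  symmetric : (G : Graph 10) → Dec (∀ u v → G u v ≡ G v u)
  symmetric G = all? λ u → all? λ v → G u v Bool.≟ G v u

  sym-T : ∀ u v → T₀ u v ≡ T₀ v u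
  sym-T = from-yes (symmetric T₀)

  sym-H : ∀ u v → H₀ u v ≡ H₀ v u
  sym-H = from-yes (symmetric H₀)

  distance-T : IsDistance T₀ dist-T
  distance-T = from-yes (isDistance? T₀ dist-T)

  distance-H : IsDistance H₀ dist-H
  distance-H = from-yes (isDistance? H₀ dist-H)

  tree-T : IsTree T₀
  tree-T = (sym-T , from-yes (all? λ u → T₀ u u Bool.≟ Bool.false)) ,
           Distance.connected distance-T ,
           CycleSearch.no-closing-path⇒acyclic T₀ 10
             (from-yes (all? λ x → all? λ c → Adj? T₀ x c →-dec
                          (CycleSearch.closes T₀ 10 x c [] 2 Bool.≟ Bool.false)))

  leaves-in : (G : Graph 10) (L : Subset 10) → Dec (∀ u → u ∈ₛ L → IsLeaf G u)
  leaves-in G L = all? λ u → (u ∈ₛ? L) →-dec isLeaf? G u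

  sdim-T : IsSdim T₀ 5
  sdim-T = IsSdim-by-leaves sym-T W L
    (DistanceResolving⇒StrongResolving (from-yes (distanceResolving? W)))
    refl (from-yes (leaves-in T₀ L) _) refl
    where
    open Distance distance-T
    W = ⁅ # 0 ⁆ ∪ ⁅ # 1 ⁆ ∪ ⁅ # 3 ⁆ ∪ ⁅ # 5 ⁆ ∪ ⁅ # 8 ⁆
    L = W ∪ ⁅ # 9 ⁆

  sdim-H : IsSdim H₀ 3
  sdim-H = IsSdim-by-leaves sym-H W L
    (DistanceResolving⇒StrongResolving (from-yes (distanceResolving? W)))
    refl (from-yes (leaves-in H₀ L) _) refl
    where
    open Distance distance-H
    W = ⁅ # 1 ⁆ ∪ ⁅ # 3 ⁆ ∪ ⁅ # 5 ⁆
    L = W ∪ ⁅ # 8 ⁆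

proposition3p3 : (∀ (n : ℕ) (T : Graph n) → 3 ≤ n → IsTree T →
    ∀ (a b : Fin n) → ¬ a ≡ b → ¬ Adj T a b →
    ∀ (s t : ℕ) → IsSdim T s → IsSdim (addEdge T a b) t → s ≤ t + 2)
    ×
    (∃[ n ] Σ (Graph n) λ T → 3 ≤ n × IsTree T ×
    Σ (Fin n) λ a → Σ (Fin n) λ b → ¬ a ≡ b × ¬ Adj T a b ×
    ∃[ s ] ∃[ t ] (IsSdim T s × IsSdim (addEdge T a b) t × t + 2 ≡ s))
proposition3p3 =
  (λ _ T _ tree a b _ _ _ _ → AddEdge.sdim-addEdge-≥ T a b tree) ,
  (10 , T₀ , s≤s (s≤s (s≤s z≤n)) , tree-T , # 9 , # 0 , (λ ()) , (λ ()) , 5 , 3 , sdim-T , sdim-H , refl)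
  where open Example
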